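{- Let $K=\mathbb{Q}(\sqrt{D})$ where $D\in\mathbb{Z}_{\ge2}$ is squarefree. For all $\alpha,\beta\in K$, if $\alpha\prec\beta$ then $\alpha<_{\mathrm{LEX}}\beta$.
   Context: Let $\omega_D=\sqrt{D}$ if $D\equiv2,3\pmod4$ and $\omega_D=\frac{1+\sqrt D}{2}$ if $D\equiv1\pmod4$; $(1,\omega_D)$ is a basis of $K$ over $\mathbb{Q}$. For $\alpha=a+b\omega_D$ and $\beta=c+d\omega_D$ with $a,b,c,d\in\mathbb{Q}$, $\alpha<_{\mathrm{LEX}}\beta$ means either $a<c$, or $a=c$ and $b<d$. For $\alpha,\beta\in K$, $\alpha\prec\beta$ means $\beta-\alpha$ is totally positive, i.e. $\beta-\alpha>0$ and $(\beta-\alpha)'>0$, where $'$ denotes Galois conjugation. -}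

module Defs where

open import Data.Nat as ℕ using (ℕ; _%_; _≡ᵇ_)
open import Data.Nat.Divisibility using (_∣_)
open import Data.Integer using (+_)
open import Data.Rational using (ℚ; 0ℚ; _+_; _*_; -_; _-_; _<_; _≤_; ½; _/_)
open import Data.Product using (_×_)
open import Data.Sum using (_⊎_)
open import Data.Bool using (if_then_else_)
open import Relation.Binary.PropositionalEquality using (_≡_)

SquareFree : ℕ → Set
SquareFree D = ∀ (n : ℕ) → (n ℕ.* n) ∣ D → n ≡ 1

Dℚ : ℕ → ℚ
Dℚ D = + D / 1

-- An element α = a + b·ω_D of K = ℚ(√D), given by its coordinates
-- with respect to the basis (1, ω_D).
record K : Set where
  constructor mk
  field
    a : ℚ
    b : ℚ
open K public

_−K_ : K → K → K
mk a b −K mk c d = mk (a - c) (b - d)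

-- coordinates (p , q) with α = p + q √D
record SqrtCoords : Set where
  constructor sc
  field
    p : ℚ
    q : ℚ

toSqrt : ℕ → K → SqrtCoords
toSqrt D (mk x y) =
  if (D % 4) ≡ᵇ 1
    then sc (x + ½ * y) (½ * y)   -- ω_D = (1 + √D)/2
    else sc x y                   -- ω_D = √D

-- q·√D > r  (real inequality), decided via squares of rationals
SqrtGt : ℕ → ℚ → ℚ → Set
SqrtGt D q r =
     (0ℚ ≤ q × r < 0ℚ)
  ⊎ (0ℚ ≤ q × 0ℚ ≤ r × r * r < q * q * Dℚ D)
  ⊎ (q < 0ℚ × r < 0ℚ × q * q * Dℚ D < r * r)

PosSqrt : ℕ → SqrtCoords → Set
PosSqrt D (sc p q) = SqrtGt D q (- p)

conjSqrt : SqrtCoords → SqrtCoords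
conjSqrt (sc p q) = sc p (- q)

TotPos : ℕ → K → Set
TotPos D α = PosSqrt D (toSqrt D α) × PosSqrt D (conjSqrt (toSqrt D α))

_≺[_]_ : K → ℕ → K → Set
α ≺[ D ] β = TotPos D (β −K α)

_<LEX_ : K → K → Set
mk a b <LEX mk c d = a < c ⊎ (a ≡ c × b < d)

-- Write β − α = p + q√D. If both p + q√D and p − q√D are positive then
-- |q|√D < p, and since D ≥ 1 also |q| < p.
-- In the basis (1, √D) the first coordinate of β − α is p itself; in the
-- basis (1, (1 + √D)/2) it is p − q, which is positive because q ≤ |q|.
module Submission where

open import Defs
open import Data.Nat as ℕ using (ℕ)
import Data.Nat.Properties as ℕ
import Data.Integer as ℤ
import Data.Integer.Properties as ℤ
open import Data.Nat.Coprimality as Coprime using (1-coprimeTo)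
open import Data.Rational
  using (0ℚ; 1ℚ; -_; _-_; _+_; _*_; _<_; _≤_; ∣_∣; *≤*; nonNegative; nonPositive)
open import Data.Rational.Properties
open import Algebra.Properties.Group +-0-group using (⁻¹-involutive)
open import Data.Bool using (true; false)
open import Data.Product using (_,_)
open import Data.Sum using (inj₁; inj₂)
open import Data.Empty using (⊥-elim)
open import Relation.Binary.PropositionalEquality
  using (_≡_; refl; sym; trans; cong; subst; subst₂)

1≤Dℚ : ∀ {D} → 1 ℕ.≤ D → 1ℚ ≤ Dℚ D
1≤Dℚ {D} 1≤D rewrite normalize-coprime {D} {0} (Coprime.sym (1-coprimeTo D)) =
  *≤* (subst (ℤ.+ 1 ℤ.≤_) (sym (ℤ.*-identityʳ (ℤ.+ D))) (ℤ.+≤+ 1≤D))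

p≤∣p∣ : ∀ p → p ≤ ∣ p ∣
p≤∣p∣ p with ≤-total 0ℚ p
... | inj₁ 0≤p = ≤-reflexive (sym (0≤p⇒∣p∣≡p 0≤p))
... | inj₂ p≤0 = ≤-trans p≤0 (0≤∣p∣ p)

nonPos⇒∣p∣≡-p : ∀ {p} → p ≤ 0ℚ → ∣ p ∣ ≡ - p
nonPos⇒∣p∣≡-p {p} p≤0 = trans (sym (∣-p∣≡∣p∣ p)) (0≤p⇒∣p∣≡p (neg-antimono-≤ p≤0))

neg-swap-< : ∀ {p q} → - p < q → - q < p
neg-swap-< {p} {q} -p<q = subst (- q <_) (⁻¹-involutive p) (neg-antimono-< -p<q)

+-cancelʳ-< : ∀ r {p q} → p + r < q + r → p < q
+-cancelʳ-< r {p} {q} p+r<q+r = subst₂ _<_ (cancel p) (cancel q) (+-monoˡ-< (- r) p+r<q+r)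
  where
  cancel : ∀ x → x + r - r ≡ x
  cancel x = trans (+-assoc x r (- r)) (trans (cong (x +_) (+-inverseʳ r)) (+-identityʳ x))

0<q-p⇒p<q : ∀ {p q} → 0ℚ < q - p → p < q
0<q-p⇒p<q {p} {q} 0<q-p = +-cancelʳ-< (- p) (subst (_< q - p) (sym (+-inverseʳ p)) 0<q-p)

q<p+q⇒0<p : ∀ {p q} → q < p + q → 0ℚ < p
q<p+q⇒0<p {p} {q} q<p+q = +-cancelʳ-< q (subst (_< p + q) (sym (+-identityˡ q)) q<p+q)

square-antitone-nonPos : ∀ {q r} → q ≤ r → r ≤ 0ℚ → r * r ≤ q * q
square-antitone-nonPos {q} {r} q≤r r≤0 =
  ≤-trans (*-monoʳ-≤-nonPos r {{nonPositive r≤0}} q≤r)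
          (*-monoˡ-≤-nonPos q {{nonPositive (≤-trans q≤r r≤0)}} q≤r)

≤-*-≥1 : ∀ {x y} → 0ℚ ≤ x → 1ℚ ≤ y → x ≤ x * y
≤-*-≥1 {x} {y} 0≤x 1≤y =
  subst (_≤ x * y) (*-identityʳ x) (*-monoˡ-≤-nonNeg x {{nonNegative 0≤x}} 1≤y)

-- For q ≤ 0 and D ≥ 1 we have q√D ≤ q.
sqrtGt-nonPos⇒< : ∀ D {q r} → 1ℚ ≤ Dℚ D → q ≤ 0ℚ → SqrtGt D q r → r < q
sqrtGt-nonPos⇒< _ _ q≤0 (inj₁ (0≤q , r<0)) = subst (_ <_) (≤-antisym 0≤q q≤0) r<0
sqrtGt-nonPos⇒< D {q} {r} 1≤D q≤0 (inj₂ (inj₁ (0≤q , 0≤r , r²<q²D))) =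
  ⊥-elim (<-irrefl refl (<-≤-trans r²<0 0≤r²))
  where
  q²D≡0 : q * q * Dℚ D ≡ 0ℚ
  q²D≡0 rewrite ≤-antisym q≤0 0≤q | *-zeroˡ 0ℚ = *-zeroˡ (Dℚ D)
  r²<0 : r * r < 0ℚ
  r²<0 = subst (r * r <_) q²D≡0 r²<q²D
  0≤r² : 0ℚ ≤ r * r
  0≤r² = nonNegative⁻¹ (r * r) {{nonNeg*nonNeg⇒nonNeg r {{nonNegative 0≤r}} r {{nonNegative 0≤r}}}}
sqrtGt-nonPos⇒< D {q} {r} 1≤D q≤0 (inj₂ (inj₂ (_ , r<0 , q²D<r²))) =
  ≰⇒> λ q≤r →
    <-irrefl refl (<-≤-trans q²D<r² (≤-trans (square-antitone-nonPos q≤r (<⇒≤ r<0)) q²≤q²D))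
  where
  q²≤q²D : q * q ≤ q * q * Dℚ D
  q²≤q²D = ≤-*-≥1 0≤q² 1≤D
    where
    0≤q² : 0ℚ ≤ q * q
    0≤q² = nonNegative⁻¹ (q * q) {{nonPos*nonPos⇒nonPos q {{nonPositive q≤0}} q {{nonPositive q≤0}}}}

posSqrt∧conj⇒∣q∣<p : ∀ D {p q} → 1ℚ ≤ Dℚ D →
  PosSqrt D (sc p q) → PosSqrt D (conjSqrt (sc p q)) → ∣ q ∣ < p
posSqrt∧conj⇒∣q∣<p D {p} {q} 1≤D pos pos′ with ≤-total q 0ℚ
... | inj₁ q≤0 = subst (_< p) (sym (nonPos⇒∣p∣≡-p q≤0))
  (neg-swap-< (sqrtGt-nonPos⇒< D 1≤D q≤0 pos))
... | inj₂ 0≤q = subst₂ _<_ (trans (⁻¹-involutive q) (sym (0≤p⇒∣p∣≡p 0≤q))) refl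
  (neg-swap-< (sqrtGt-nonPos⇒< D 1≤D (neg-antimono-≤ 0≤q) pos′))

lemma3p1 : (D : ℕ) → 2 ℕ.≤ D → SquareFree D →
    (α β : K) → α ≺[ D ] β → α <LEX β
lemma3p1 D 2≤D _ α β (pos , pos′) with D ℕ.% 4 ℕ.≡ᵇ 1
... | true = inj₁ (0<q-p⇒p<q (q<p+q⇒0<p
  (≤-<-trans (p≤∣p∣ _) (posSqrt∧conj⇒∣q∣<p D (1≤Dℚ (ℕ.<⇒≤ 2≤D)) pos pos′))))
... | false = inj₁ (0<q-p⇒p<q
  (≤-<-trans (0≤∣p∣ _) (posSqrt∧conj⇒∣q∣<p D (1≤Dℚ (ℕ.<⇒≤ 2≤D)) pos pos′)))
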